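{- For every integer $k\ge 0$, $f(k+1) \le 2^{2^k} + \left(2^{2^k-1}-1\right)f(k)$.
   Context: $\mu$ is the morphism on binary words with $\mu(0)=01$, $\mu(1)=10$; $\mu^n$ is its $n$-fold iterate. Words $CS(k)$, $k\ge 0$, are defined recursively: $CS(0)=0$ (the one-letter word). For $k\ge 1$, let $n=2^k$, $m=2^{k-1}$, $X=\mu^n(0)$, $Y=\mu^n(1)$, and write $X=x_0x_1\cdots x_{2^m-1}$, $Y=y_0y_1\cdots y_{2^m-1}$ as concatenations of $2^m$ consecutive blocks of length $2^m$ (each block is $\mu^m(0)$ or $\mu^m(1)$). For $0\le i<2^m-1$ define $cs_i=x_i$ if $i$ is even; if $i$ is odd, $cs_i=x_i$ when $x_i=y_{i+1}$ and $cs_i=CS(k-1)$ otherwise. Then $CS(k)=cs_0cs_1\cdots cs_{2^m-2}$ (a common subsequence of $\mu^{2^k}(0)$ and $\mu^{2^k}(1)$). Define $f(k)=2^{2^k}-|CS(k)|$. -}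

module Defs where

open import Data.Bool using (Bool; true; false; not; if_then_else_)
import Data.Bool.Properties as BoolP
open import Data.Nat using (ℕ; zero; suc; _+_; _*_; _∸_; _^_; _%_; _≡ᵇ_)
open import Data.List using (List; []; _∷_; _++_; concatMap; take; drop; upTo; length)
import Data.List.Properties as ListP
open import Data.Integer using (ℤ; +_; _-_)
open import Relation.Nullary.Decidable using (does)

-- Binary words: letters are Bool, with false = 0 and true = 1.
Word : Set
Word = List Bool

μ : Word → Word
μ = concatMap (λ b → b ∷ not b ∷ [])

μ^ : ℕ → Word → Word
μ^ zero    w = w
μ^ (suc n) w = μ (μ^ n w)

zero𝔹 one𝔹 : Word
zero𝔹 = false ∷ []
one𝔹  = true ∷ []

block : ℕ → ℕ → Word → Word
block L i w = take L (drop (i * L) w)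

_=w_ : Word → Word → Bool
u =w v = does (ListP.≡-dec BoolP._≟_ u v)

CS : ℕ → Word
CS zero    = zero𝔹
CS (suc j) = concatMap cs (upTo (2 ^ m ∸ 1))
  where
  n m : ℕ
  n = 2 ^ suc j
  m = 2 ^ j
  X Y : Word
  X = μ^ n zero𝔹
  Y = μ^ n one𝔹
  x y : ℕ → Word
  x i = block (2 ^ m) i X
  y i = block (2 ^ m) i Y
  cs : ℕ → Word
  cs i = if i % 2 ≡ᵇ 0 then x i
         else (if x i =w y (suc i) then x i else CS j)

-- f(k) = 2^(2^k) - |CS(k)|, computed in ℤ (no truncation).
f : ℕ → ℤ
f k = + (2 ^ (2 ^ k)) - + length (CS k)

module Submission where

-- Put L = 2^(2^k), h = 2^(2^k - 1) (so L = 2h) and c = |CS(k)|.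
-- By definition CS(k+1) is the concatenation of the L - 1 = 2h - 1 words cs_i, where
-- x_i is the i-th length-L block of μ^(2^(k+1))(0), a word of length L·L.  Hence
--   * every block x_i with i < L has length exactly L, so each even-indexed cs_i has
--     length L, and each odd-indexed cs_i (which is x_i or CS(k)) has length ≥ c,
--     provided c ≤ L;
--   * c ≤ L does hold for every k, since each cs_i has length ≤ L, so that
--     |CS(k+1)| ≤ (L - 1)·L ≤ 2^(2^(k+1)).
-- With h even-indexed and h - 1 odd-indexed pieces this gives
--   |CS(k+1)| ≥ h·L + (h - 1)·c,
-- and since L·L = 2h·L the defect is f(k+1) = L·L - |CS(k+1)| ≤ L + (h - 1)(L - c).

open import Defs
open import Data.Nat using (ℕ; suc; _^_; _∸_)
open import Data.Integer using (ℤ; +_; _+_; _*_; _-_; _≤_)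

import Data.Nat as N
open N using (zero; _%_; _≡ᵇ_)
import Data.Nat.Properties as NP
open import Data.Nat.DivMod using (m*n%n≡0)
import Data.Nat.Tactic.RingSolver as NatSolver
open import Data.Bool using (true; false; if_then_else_)
open import Data.List using (List; []; _∷_; _++_; concatMap; take; drop; upTo; length)
import Data.List.Properties as LP
import Data.Integer.Properties as ZP
open import Data.Integer using (+≤+)
open import Data.Integer.Tactic.RingSolver using (solve-∀)
open import Relation.Binary.PropositionalEquality
open import Function using (_∘_)

sumBelow : ℕ → (ℕ → ℕ) → ℕ
sumBelow zero    a = 0
sumBelow (suc n) a = sumBelow n a N.+ a n

length-concatMap-upTo : ∀ {A : Set} (g : ℕ → List A) n →
                        length (concatMap g (upTo n)) ≡ sumBelow n (length ∘ g)
length-concatMap-upTo g zero    = refl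
length-concatMap-upTo g (suc n) = begin
    length (concatMap g (upTo (suc n)))
  ≡⟨ cong (length ∘ concatMap g) (sym (LP.upTo-∷ʳ n)) ⟩
    length (concatMap g (upTo n ++ n ∷ []))
  ≡⟨ cong length (LP.concatMap-++ g (upTo n) (n ∷ [])) ⟩
    length (concatMap g (upTo n) ++ (g n ++ []))
  ≡⟨ LP.length-++ (concatMap g (upTo n)) ⟩
    length (concatMap g (upTo n)) N.+ length (g n ++ [])
  ≡⟨ cong₂ N._+_ (length-concatMap-upTo g n) (cong length (LP.++-identityʳ (g n))) ⟩
    sumBelow n (length ∘ g) N.+ length (g n) ∎
  where open ≡-Reasoning

sumBelow-≤ : ∀ (a : ℕ → ℕ) b n → (∀ i → a i N.≤ b) → sumBelow n a N.≤ n N.* b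
sumBelow-≤ a b zero    a≤b = N.z≤n
sumBelow-≤ a b (suc n) a≤b = NP.≤-trans (NP.+-mono-≤ (sumBelow-≤ a b n a≤b) (a≤b n))
                                         (NP.≤-reflexive (NP.+-comm (n N.* b) b))

sumBelow-alternating-≥ : ∀ (a : ℕ → ℕ) p q t →
                         (∀ s → s N.≤ t → p N.≤ a (s N.* 2)) →
                         (∀ s → s N.< t → q N.≤ a (suc (s N.* 2))) →
                         suc t N.* p N.+ t N.* q N.≤ sumBelow (suc (t N.* 2)) a
sumBelow-alternating-≥ a p q zero    even odd =
  NP.≤-trans (NP.≤-reflexive (trans (NP.+-identityʳ (p N.+ 0)) (NP.+-identityʳ p))) (even 0 N.z≤n)
sumBelow-alternating-≥ a p q (suc t) even odd =
  NP.≤-trans (NP.≤-reflexive (regroup t p q))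
    (NP.+-mono-≤ (NP.+-mono-≤ (sumBelow-alternating-≥ a p q t (λ s s≤t → even s (NP.m≤n⇒m≤1+n s≤t))
                                                              (λ s s<t → odd s (NP.m≤n⇒m≤1+n s<t)))
                              (odd t NP.≤-refl))
                 (even (suc t) NP.≤-refl))
  where
  regroup : ∀ t p q → suc (suc t) N.* p N.+ suc t N.* q ≡ suc t N.* p N.+ t N.* q N.+ q N.+ p
  regroup = NatSolver.solve-∀

length-μ : ∀ w → length (μ w) ≡ 2 N.* length w
length-μ []      = refl
length-μ (b ∷ w) = cong suc (trans (cong suc (length-μ w)) (sym (NP.+-suc (length w) (length w N.+ 0))))

length-μ^ : ∀ n w → length (μ^ n w) ≡ 2 ^ n N.* length w
length-μ^ zero    w = sym (NP.+-identityʳ (length w))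
length-μ^ (suc n) w = begin
    length (μ (μ^ n w))       ≡⟨ length-μ (μ^ n w) ⟩
    2 N.* length (μ^ n w)     ≡⟨ cong (2 N.*_) (length-μ^ n w) ⟩
    2 N.* (2 ^ n N.* length w) ≡⟨ NP.*-assoc 2 (2 ^ n) (length w) ⟨
    2 ^ suc n N.* length w    ∎
  where open ≡-Reasoning

2^2^suc : ∀ k → 2 ^ (2 ^ suc k) ≡ 2 ^ (2 ^ k) N.* 2 ^ (2 ^ k)
2^2^suc k = begin
    2 ^ (2 ^ k N.+ (2 ^ k N.+ 0)) ≡⟨ cong (λ e → 2 ^ (2 ^ k N.+ e)) (NP.+-identityʳ (2 ^ k)) ⟩
    2 ^ (2 ^ k N.+ 2 ^ k)         ≡⟨ NP.^-distribˡ-+-* 2 (2 ^ k) (2 ^ k) ⟩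
    2 ^ (2 ^ k) N.* 2 ^ (2 ^ k)   ∎
  where open ≡-Reasoning

length-block-≤ : ∀ L i (w : Word) → length (block L i w) N.≤ L
length-block-≤ L i w = NP.≤-trans (NP.≤-reflexive (LP.length-take L (drop (i N.* L) w))) (NP.m⊓n≤m L _)

length-block : ∀ L i (w : Word) → suc i N.* L N.≤ length w → length (block L i w) ≡ L
length-block L i w inside = begin
    length (take L (drop (i N.* L) w))   ≡⟨ LP.length-take L (drop (i N.* L) w) ⟩
    L N.⊓ length (drop (i N.* L) w)      ≡⟨ cong (L N.⊓_) (LP.length-drop (i N.* L) w) ⟩
    L N.⊓ (length w ∸ i N.* L)           ≡⟨ NP.m≤n⇒m⊓n≡m (NP.m+n≤o⇒m≤o∸n L inside) ⟩
    L                                     ∎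
  where open ≡-Reasoning

module Pieces (k : ℕ) where
  L c : ℕ
  L = 2 ^ (2 ^ k)
  c = length (CS k)

  X Y : Word
  X = μ^ (2 ^ suc k) zero𝔹
  Y = μ^ (2 ^ suc k) one𝔹

  x y : ℕ → Word
  x i = block L i X
  y i = block L i Y

  cs : ℕ → Word
  cs i = if i % 2 ≡ᵇ 0 then x i
         else (if x i =w y (suc i) then x i else CS k)

  length-CS-suc : length (CS (suc k)) ≡ sumBelow (L ∸ 1) (length ∘ cs)
  length-CS-suc = length-concatMap-upTo cs (L ∸ 1)

  length-X : length X ≡ L N.* L
  length-X = trans (length-μ^ (2 ^ suc k) zero𝔹) (trans (NP.*-identityʳ _) (2^2^suc k))

  length-x : ∀ i → i N.< L → length (x i) ≡ L
  length-x i i<L = length-block L i X (NP.≤-trans (NP.*-monoˡ-≤ L i<L) (NP.≤-reflexive (sym length-X)))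

  length-cs-≤ : c N.≤ L → ∀ i → length (cs i) N.≤ L
  length-cs-≤ c≤L i with i % 2 ≡ᵇ 0 | x i =w y (suc i)
  ... | true  | _     = length-block-≤ L i X
  ... | false | true  = length-block-≤ L i X
  ... | false | false = c≤L

  length-cs-≥ : c N.≤ L → ∀ i → i N.< L → c N.≤ length (cs i)
  length-cs-≥ c≤L i i<L with i % 2 ≡ᵇ 0 | x i =w y (suc i)
  ... | true  | _     = NP.≤-trans c≤L (NP.≤-reflexive (sym (length-x i i<L)))
  ... | false | true  = NP.≤-trans c≤L (NP.≤-reflexive (sym (length-x i i<L)))
  ... | false | false = NP.≤-refl

  length-cs-even : ∀ s → s N.* 2 N.< L → length (cs (s N.* 2)) ≡ L
  length-cs-even s s2<L rewrite m*n%n≡0 s 2 ⦃ _ ⦄ = length-x (s N.* 2) s2<L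

-- |CS(k)| ≤ 2^(2^k): CS(k+1) consists of L - 1 pieces of length at most L.
length-CS-≤ : ∀ k → length (CS k) N.≤ 2 ^ (2 ^ k)
length-CS-≤ zero    = N.s≤s N.z≤n
length-CS-≤ (suc k) = begin
    length (CS (suc k))                  ≡⟨ length-CS-suc ⟩
    sumBelow (L ∸ 1) (length ∘ cs)       ≤⟨ sumBelow-≤ (length ∘ cs) L (L ∸ 1) (length-cs-≤ (length-CS-≤ k)) ⟩
    (L ∸ 1) N.* L                         ≤⟨ NP.*-monoˡ-≤ L (NP.m∸n≤m L 1) ⟩
    L N.* L                               ≡⟨ 2^2^suc k ⟨
    2 ^ (2 ^ suc k)                       ∎
  where
  open Pieces k
  open NP.≤-Reasoning

-- Writing 2^(2^k) = 2(t + 1): |CS(k+1)| ≥ (t + 1)·2^(2^k) + t·|CS(k)|, counting the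
-- t + 1 full even-indexed blocks and the t odd-indexed pieces of length ≥ |CS(k)|.
length-CS-suc-≥ : ∀ k t → 2 ^ (2 ^ k) ≡ suc t N.* 2 →
                  suc t N.* 2 ^ (2 ^ k) N.+ t N.* length (CS k) N.≤ length (CS (suc k))
length-CS-suc-≥ k t L≡2t+2 = begin
    suc t N.* L N.+ t N.* c               ≤⟨ sumBelow-alternating-≥ (length ∘ cs) L c t even odd ⟩
    sumBelow (suc (t N.* 2)) (length ∘ cs) ≡⟨ cong (λ n → sumBelow (n ∸ 1) (length ∘ cs)) L≡2t+2 ⟨
    sumBelow (L ∸ 1) (length ∘ cs)        ≡⟨ length-CS-suc ⟨
    length (CS (suc k))                    ∎
  where
  open Pieces k
  open NP.≤-Reasoning
  index<L : ∀ i → i N.≤ suc (t N.* 2) → i N.< L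
  index<L i i≤ = NP.≤-trans (N.s≤s i≤) (NP.≤-reflexive (sym L≡2t+2))
  even : ∀ s → s N.≤ t → L N.≤ length (cs (s N.* 2))
  even s s≤t = NP.≤-reflexive (sym (length-cs-even s (index<L (s N.* 2) (NP.m≤n⇒m≤1+n (NP.*-monoˡ-≤ 2 s≤t)))))
  odd : ∀ s → s N.< t → c N.≤ length (cs (suc (s N.* 2)))
  odd s s<t = length-cs-≥ (length-CS-≤ k) (suc (s N.* 2)) (index<L _ (N.s≤s (NP.*-monoˡ-≤ 2 (NP.<⇒≤ s<t))))

2^2^k-halve : ∀ k → 2 ^ (2 ^ k) ≡ 2 ^ (2 ^ k ∸ 1) N.* 2
2^2^k-halve k = begin
    2 ^ (2 ^ k)                ≡⟨ cong (2 ^_) (NP.suc-pred (2 ^ k) ⦃ NP.m^n≢0 2 k ⦄) ⟨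
    2 N.* 2 ^ (2 ^ k ∸ 1)      ≡⟨ NP.*-comm 2 (2 ^ (2 ^ k ∸ 1)) ⟩
    2 ^ (2 ^ k ∸ 1) N.* 2      ∎
  where open ≡-Reasoning

defect-identity : ∀ τ γ → let ℓ = (+ 1 + τ) * + 2 in
                  ℓ * ℓ - ((+ 1 + τ) * ℓ + τ * γ) ≡ ℓ + τ * (ℓ - γ)
defect-identity = solve-∀

defect-bound : ∀ L t c len → L ≡ suc t N.* 2 → suc t N.* L N.+ t N.* c N.≤ len →
               + (L N.* L) - + len ≤ + L + (+ suc t - + 1) * (+ L - + c)
defect-bound L t c len L≡2t+2 lower = begin
    + (L N.* L) - + len
  ≤⟨ ZP.+-monoʳ-≤ (+ (L N.* L)) (ZP.neg-mono-≤ (+≤+ lower)) ⟩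
    + (L N.* L) - + (suc t N.* L N.+ t N.* c)
  ≡⟨ cong₂ _-_ (ZP.pos-* L L) (trans (ZP.pos-+ (suc t N.* L) (t N.* c))
                                     (cong₂ _+_ (ZP.pos-* (suc t) L) (ZP.pos-* t c))) ⟩
    + L * + L - (+ suc t * + L + + t * + c)
  ≡⟨ cong (λ ℓ → ℓ * ℓ - (+ suc t * ℓ + + t * + c) ) ℓ≡2τ+2 ⟩
    ((+ 1 + + t) * + 2) * ((+ 1 + + t) * + 2) - ((+ 1 + + t) * ((+ 1 + + t) * + 2) + + t * + c)
  ≡⟨ defect-identity (+ t) (+ c) ⟩
    (+ 1 + + t) * + 2 + + t * ((+ 1 + + t) * + 2 - + c)
  ≡⟨ cong (λ ℓ → ℓ + + t * (ℓ - + c)) ℓ≡2τ+2 ⟨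
    + L + (+ suc t - + 1) * (+ L - + c)
  ∎
  where
  open ZP.≤-Reasoning
  ℓ≡2τ+2 : + L ≡ (+ 1 + + t) * + 2
  ℓ≡2τ+2 = trans (cong +_ L≡2t+2) (ZP.pos-* (suc t) 2)

lemma1 : (k : ℕ) →
    f (suc k) ≤ + (2 ^ (2 ^ k)) + (+ (2 ^ (2 ^ k ∸ 1)) - + 1) * f k
lemma1 k = begin
    f (suc k)
  ≡⟨ cong (λ n → + n - + length (CS (suc k))) (2^2^suc k) ⟩
    + (L N.* L) - + length (CS (suc k))
  ≤⟨ defect-bound L t (length (CS k)) _ L≡2t+2 (length-CS-suc-≥ k t L≡2t+2) ⟩
    + L + (+ suc t - + 1) * f k
  ≡⟨ cong (λ n → + L + (+ n - + 1) * f k) h≡1+t ⟩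
    + L + (+ h - + 1) * f k
  ∎
  where
  open ZP.≤-Reasoning
  L h t : ℕ
  L = 2 ^ (2 ^ k)
  h = 2 ^ (2 ^ k ∸ 1)
  t = h ∸ 1
  h≡1+t : suc t ≡ h
  h≡1+t = NP.suc-pred h ⦃ NP.m^n≢0 2 (2 ^ k ∸ 1) ⦄
  L≡2t+2 : L ≡ suc t N.* 2
  L≡2t+2 = trans (2^2^k-halve k) (cong (N._* 2) (sym h≡1+t))
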